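{- Let $\Delta$ and $x$ be positive integers and let $p\in\mathbb{N}^\Delta$ be defined by $p[j]=\lceil x/\Delta\rceil$ if $j\le (x \bmod \Delta)$ and $p[j]=\lfloor x/\Delta\rfloor$ otherwise, for $1\le j\le\Delta$. Then for every potential $p'\in\mathbb{N}^\Delta$ with $\omega(p')=\omega(p)$ it holds that $p'\ge p$.
   Context: A potential is a vector $p'\in\mathbb{N}^\Delta$ arising as follows: for some dag (directed acyclic graph without parallel arcs or loops) with topological ordering $v_1,\ldots,v_n$ and some $0\le i\le n$, $p'[l]$ is the number of vertices among $v_1,\ldots,v_i$ with at least $l$ neighbors among $v_{i+1},\ldots,v_n$ (in particular $p'[1]\ge p'[2]\ge\cdots\ge p'[\Delta]$). The value is $\omega(q)=\sum_{l=1}^\Delta q[l]$. For $q,q'\in\mathbb{N}^\Delta$, $q\ge q'$ means $\sum_{l=1}^j q[l]\ge\sum_{l=1}^j q'[l]$ for all $1\le j\le\Delta$. -}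

module Defs where

open import Data.Nat using (ℕ; zero; suc; _+_; _∸_; _≤_; _<_; _≥_; NonZero)
open import Data.Nat.DivMod using (_/_; _%_)
open import Data.Fin using (Fin; toℕ)
open import Data.Bool using (Bool; true; false; _∨_; if_then_else_)
open import Data.Product using (Σ; _×_; ∃; ∃-syntax)
open import Relation.Binary.PropositionalEquality using (_≡_)
open import Relation.Nullary.Decidable using (⌊_⌋)
open import Data.Nat using (_≤?_; _<?_)

count : ∀ {n} → (Fin n → Bool) → ℕ
count {zero}  P = 0
count {suc n} P = (if P Data.Fin.zero then 1 else 0) + count {n} (λ k → P (Data.Fin.suc k))

sumFin : ∀ {n} → (Fin n → ℕ) → ℕ
sumFin {zero}  f = 0
sumFin {suc n} f = f Data.Fin.zero + sumFin {n} (λ k → f (Data.Fin.suc k))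

-- prefix sum: sum of q[0..m-1] (0-indexed), i.e. q[1] + … + q[m] in 1-indexed notation
prefixSum : ∀ {Δ} → (Fin Δ → ℕ) → ℕ → ℕ
prefixSum q m = sumFin (λ k → if ⌊ toℕ k <? m ⌋ then q k else 0)

-- a vector in ℕ^Δ, entry l (1 ≤ l ≤ Δ) stored at index l-1
Vecℕ : ℕ → Set
Vecℕ Δ = Fin Δ → ℕ

ω : ∀ {Δ} → Vecℕ Δ → ℕ
ω q = sumFin q

_≽_ : ∀ {Δ} → Vecℕ Δ → Vecℕ Δ → Set
_≽_ {Δ} q q' = (j : Fin Δ) → prefixSum q (suc (toℕ j)) ≥ prefixSum q' (suc (toℕ j))

-- A dag on vertices v_1,…,v_n (represented by Fin n, v_{k+1} ↦ k) for which
-- v_1,…,v_n is a topological ordering: a simple digraph (at most one arc u→v,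
-- encoded by a Bool) all of whose arcs go from earlier to later vertices
-- (hence acyclic and loopless).
record TopDag (n : ℕ) : Set where
  field
    arc      : Fin n → Fin n → Bool
    forward  : ∀ u v → arc u v ≡ true → toℕ u < toℕ v

adj : ∀ {n} → TopDag n → Fin n → Fin n → Bool
adj G u v = TopDag.arc G u v ∨ TopDag.arc G v u

-- number of neighbours of u among v_{i+1},…,v_n (i.e. 0-indexed positions ≥ i)
laterNbrs : ∀ {n} → TopDag n → ℕ → Fin n → ℕ
laterNbrs G i u = count (λ w → if ⌊ i ≤? toℕ w ⌋ then adj G u w else false)

-- the vector of the definition: entry l (1-indexed) = #{ u among v_1..v_i with ≥ l later neighbours }
potentialOf : ∀ {n} (Δ : ℕ) → TopDag n → ℕ → Vecℕ Δ
potentialOf Δ G i l =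
  count (λ u → if ⌊ toℕ u <? i ⌋ then ⌊ suc (toℕ l) ≤? laterNbrs G i u ⌋ else false)

IsPotential : (Δ : ℕ) → Vecℕ Δ → Set
IsPotential Δ q =
  Σ ℕ λ n → Σ (TopDag n) λ G → Σ ℕ λ i → (i ≤ n) × ((l : Fin Δ) → q l ≡ potentialOf Δ G i l)

ceilDiv : (x Δ : ℕ) → .{{NonZero Δ}} → ℕ
ceilDiv x Δ = (x + (Δ ∸ 1)) / Δ

balanced : (Δ x : ℕ) → .{{NonZero Δ}} → Vecℕ Δ
balanced Δ x j = if ⌊ suc (toℕ j) ≤? x % Δ ⌋ then ceilDiv x Δ else x / Δ

-- A potential is antitone: raising l can only shrink the set counted in p'[l]. For an antitone
-- p' with the same total as the balanced vector p (q + 1 on the first r entries, q after), look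
-- at p'[j]. If p'[j] ≤ q, every later entry is ≤ q as well, so the first j entries of p' must
-- carry at least ω(p) − (Δ − j)q = jq + r ≥ jq + min(j, r), the j-th prefix sum of p. If
-- p'[j] > q, every earlier entry is ≥ q + 1, and j(q + 1) ≥ jq + min(j, r) as well.
module Submission where

open import Defs
open import Data.Nat using (ℕ; NonZero; zero; suc; _+_; _*_; _∸_; _≤_; _<_; _≥_; _⊓_; _≤?_; _<?_; z≤n; s≤s)
open import Data.Nat.Properties
open import Data.Nat.DivMod
open import Data.Nat.Divisibility using (n∣m*n)
open import Data.Nat.Tactic.RingSolver using (solve-∀)
open import Data.Fin as Fin using (Fin; toℕ) renaming (zero to fz; suc to fs)
open import Data.Fin.Properties using (toℕ<n)
open import Data.Bool using (Bool; true; false; if_then_else_; f≤t; b≤b) renaming (_≤_ to _≤ᴮ_)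
open import Data.Product using (_,_)
open import Function using (_∘_)
open import Relation.Binary.Core using (_Preserves_⟶_)
open import Relation.Binary.PropositionalEquality using (_≡_; refl; sym; trans; cong; cong₂; subst; _≗_; module ≡-Reasoning)
open import Relation.Nullary using (Dec; yes; no; contradiction)
open import Relation.Nullary.Decidable using (⌊_⌋; ⌊⌋-map′)

⌊<?⌋-suc : ∀ m n → ⌊ suc m <? suc n ⌋ ≡ ⌊ m <? n ⌋
⌊<?⌋-suc m n = trans (⌊⌋-map′ _ _ _) (sym (⌊⌋-map′ _ _ _))

⌊≤?⌋-antitoneˡ : ∀ {m n} k → m ≤ n → ⌊ n ≤? k ⌋ ≤ᴮ ⌊ m ≤? k ⌋
⌊≤?⌋-antitoneˡ {m} {n} k m≤n with n ≤? k | m ≤? k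
... | yes _   | yes _   = b≤b
... | no  _   | yes _   = f≤t
... | no  _   | no  _   = b≤b
... | yes n≤k | no  m≰k = contradiction (≤-trans m≤n n≤k) m≰k

count-mono : ∀ {n} {P Q : Fin n → Bool} → (∀ u → P u ≤ᴮ Q u) → count P ≤ count Q
count-mono {zero}          P≤Q = z≤n
count-mono {suc n} {P} {Q} P≤Q with P fz | Q fz | P≤Q fz
... | _ | _ | b≤b = +-monoʳ-≤ _ (count-mono (P≤Q ∘ fs))
... | _ | _ | f≤t = m≤n⇒m≤1+n (count-mono (P≤Q ∘ fs))

IsPotential⇒antitone : ∀ {Δ} {p' : Vecℕ Δ} → IsPotential Δ p' → p' Preserves Fin._≤_ ⟶ _≥_
IsPotential⇒antitone (n , G , i , _ , p'≡) {a} {b} a≤b rewrite p'≡ a | p'≡ b = count-mono counted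
  where
  counted : ∀ u → (if ⌊ toℕ u <? i ⌋ then ⌊ suc (toℕ b) ≤? laterNbrs G i u ⌋ else false)
               ≤ᴮ (if ⌊ toℕ u <? i ⌋ then ⌊ suc (toℕ a) ≤? laterNbrs G i u ⌋ else false)
  counted u with ⌊ toℕ u <? i ⌋
  ... | true  = ⌊≤?⌋-antitoneˡ (laterNbrs G i u) (s≤s a≤b)
  ... | false = b≤b

suffixSum : ∀ {n} → (Fin n → ℕ) → ℕ → ℕ
suffixSum f J = sumFin (λ k → if ⌊ toℕ k <? J ⌋ then 0 else f k)

sumFin-cong : ∀ {n} {f g : Fin n → ℕ} → f ≗ g → sumFin f ≡ sumFin g
sumFin-cong {zero}  f≗g = refl
sumFin-cong {suc n} f≗g = cong₂ _+_ (f≗g fz) (sumFin-cong (f≗g ∘ fs))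

prefixSum-cong : ∀ {n} {f g : Fin n → ℕ} → f ≗ g → ∀ J → prefixSum f J ≡ prefixSum g J
prefixSum-cong f≗g J = sumFin-cong λ k → cong (if ⌊ toℕ k <? J ⌋ then_else 0) (f≗g k)

prefixSum-zero : ∀ {n} (f : Fin n → ℕ) → prefixSum f 0 ≡ 0
prefixSum-zero {zero}  f = refl
prefixSum-zero {suc n} f = prefixSum-zero (f ∘ fs)

prefixSum-suc : ∀ {n} (f : Fin (suc n) → ℕ) J → prefixSum f (suc J) ≡ f fz + prefixSum (f ∘ fs) J
prefixSum-suc f J = cong (f fz +_) (sumFin-cong λ k →
  cong (if_then f (fs k) else 0) (⌊<?⌋-suc (toℕ k) J))

suffixSum-suc : ∀ {n} (f : Fin (suc n) → ℕ) J → suffixSum f (suc J) ≡ suffixSum (f ∘ fs) J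
suffixSum-suc f J = sumFin-cong λ k → cong (if_then 0 else f (fs k)) (⌊<?⌋-suc (toℕ k) J)

prefixSum-all : ∀ {n} (f : Fin n → ℕ) → prefixSum f n ≡ sumFin f
prefixSum-all {zero}  f = refl
prefixSum-all {suc n} f = trans (prefixSum-suc f n) (cong (f fz +_) (prefixSum-all (f ∘ fs)))

sumFin-split : ∀ {n} (f : Fin n → ℕ) J → sumFin f ≡ prefixSum f J + suffixSum f J
sumFin-split {zero}  f J       = refl
sumFin-split {suc n} f zero    = cong (_+ sumFin f) (sym (prefixSum-zero f))
sumFin-split {suc n} f (suc J) = begin
  f fz + sumFin (f ∘ fs)                                   ≡⟨ cong (f fz +_) (sumFin-split (f ∘ fs) J) ⟩
  f fz + (prefixSum (f ∘ fs) J + suffixSum (f ∘ fs) J)     ≡⟨ sym (+-assoc (f fz) _ _) ⟩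
  f fz + prefixSum (f ∘ fs) J + suffixSum (f ∘ fs) J       ≡⟨ sym (cong₂ _+_ (prefixSum-suc f J) (suffixSum-suc f J)) ⟩
  prefixSum f (suc J) + suffixSum f (suc J)                ∎
  where open ≡-Reasoning

prefixSum-lower : ∀ {n} (f : Fin n → ℕ) {m} J → J ≤ n → (∀ k → toℕ k < J → m ≤ f k) → J * m ≤ prefixSum f J
prefixSum-lower f zero _ _ = z≤n
prefixSum-lower {suc n} f {m} (suc J) (s≤s J≤n) m≤f = subst (suc J * m ≤_) (sym (prefixSum-suc f J))
  (+-mono-≤ (m≤f fz (s≤s z≤n)) (prefixSum-lower (f ∘ fs) J J≤n λ k k<J → m≤f (fs k) (s≤s k<J)))

suffixSum-upper : ∀ {n} (f : Fin n → ℕ) {m} J → (∀ k → J ≤ toℕ k → f k ≤ m) → suffixSum f J ≤ (n ∸ J) * m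
suffixSum-upper {zero}  f J       f≤m = z≤n
suffixSum-upper {suc n} f zero    f≤m =
  +-mono-≤ (f≤m fz z≤n) (suffixSum-upper (f ∘ fs) zero λ k _ → f≤m (fs k) z≤n)
suffixSum-upper {suc n} f {m} (suc J) f≤m = subst (_≤ (n ∸ J) * m) (sym (suffixSum-suc f J))
  (suffixSum-upper (f ∘ fs) J λ k J≤k → f≤m (fs k) (s≤s J≤k))

≽-respʳ : ∀ {n} {f g h : Vecℕ n} → g ≗ h → f ≽ g → f ≽ h
≽-respʳ g≗h f≽g j = subst (_≤ _) (prefixSum-cong g≗h _) (f≽g j)

staircase : ∀ n → ℕ → ℕ → Vecℕ n
staircase n q r k = if ⌊ toℕ k <? r ⌋ then suc q else q

prefixSum-staircase : ∀ {n} q r J → J ≤ n → prefixSum (staircase n q r) J ≡ J * q + J ⊓ r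
prefixSum-staircase {n} q r zero _ = prefixSum-zero (staircase n q r)
prefixSum-staircase {suc n} q zero (suc J) (s≤s J≤n) = begin
  prefixSum (staircase (suc n) q 0) (suc J)  ≡⟨ prefixSum-suc (staircase (suc n) q 0) J ⟩
  q + prefixSum (staircase n q 0) J          ≡⟨ cong (q +_) (prefixSum-staircase q 0 J J≤n) ⟩
  q + (J * q + J ⊓ 0)                        ≡⟨ cong (λ t → q + (J * q + t)) (⊓-zeroʳ J) ⟩
  q + (J * q + 0)                            ≡⟨ sym (+-assoc q (J * q) 0) ⟩
  suc J * q + suc J ⊓ 0                      ∎
  where open ≡-Reasoning
prefixSum-staircase {suc n} q (suc r) (suc J) (s≤s J≤n) = begin
  prefixSum (staircase (suc n) q (suc r)) (suc J)  ≡⟨ prefixSum-suc (staircase (suc n) q (suc r)) J ⟩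
  suc q + prefixSum (staircase (suc n) q (suc r) ∘ fs) J
    ≡⟨ cong (suc q +_) (prefixSum-cong {g = staircase n q r} (λ k → cong (if_then suc q else q) (⌊<?⌋-suc (toℕ k) r)) J) ⟩
  suc q + prefixSum (staircase n q r) J            ≡⟨ cong (suc q +_) (prefixSum-staircase q r J J≤n) ⟩
  suc q + (J * q + J ⊓ r)                          ≡⟨ cong suc (sym (+-assoc q (J * q) _)) ⟩
  suc (q + J * q + J ⊓ r)                          ≡⟨ sym (+-suc (q + J * q) _) ⟩
  suc J * q + suc (J ⊓ r)                          ∎
  where open ≡-Reasoning

antitone⇒≽staircase : ∀ {n} (f : Fin n → ℕ) q r → f Preserves Fin._≤_ ⟶ _≥_ →
  sumFin (staircase n q r) ≤ sumFin f → f ≽ staircase n q r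
antitone⇒≽staircase {n} f q r antitone total j =
  subst (_≤ prefixSum f J) (sym (prefixSum-staircase q r J J≤n)) (prefix-bound (f j ≤? q))
  where
  J = suc (toℕ j)
  J≤n : J ≤ n
  J≤n = toℕ<n j
  open ≤-Reasoning
  prefix-bound : Dec (f j ≤ q) → J * q + J ⊓ r ≤ prefixSum f J
  prefix-bound (yes fj≤q) = +-cancelˡ-≤ ((n ∸ J) * q) _ _ (begin
    (n ∸ J) * q + (J * q + J ⊓ r)         ≤⟨ +-monoʳ-≤ ((n ∸ J) * q) (+-monoʳ-≤ (J * q) (⊓-monoˡ-≤ r J≤n)) ⟩
    (n ∸ J) * q + (J * q + n ⊓ r)         ≡⟨ sym (+-assoc ((n ∸ J) * q) (J * q) (n ⊓ r)) ⟩
    (n ∸ J) * q + J * q + n ⊓ r           ≡⟨ cong (_+ n ⊓ r) (sym (*-distribʳ-+ q (n ∸ J) J)) ⟩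
    (n ∸ J + J) * q + n ⊓ r               ≡⟨ cong (λ m → m * q + n ⊓ r) (m∸n+n≡m J≤n) ⟩
    n * q + n ⊓ r                         ≡⟨ trans (sym (prefixSum-staircase q r n ≤-refl)) (prefixSum-all (staircase n q r)) ⟩
    sumFin (staircase n q r)              ≤⟨ total ⟩
    sumFin f                              ≡⟨ sumFin-split f J ⟩
    prefixSum f J + suffixSum f J         ≤⟨ +-monoʳ-≤ _ (suffixSum-upper f J λ k J≤k → ≤-trans (antitone (<⇒≤ J≤k)) fj≤q) ⟩
    prefixSum f J + (n ∸ J) * q           ≡⟨ +-comm (prefixSum f J) _ ⟩
    (n ∸ J) * q + prefixSum f J           ∎)
  prefix-bound (no fj≰q) = begin
    J * q + J ⊓ r                         ≤⟨ +-monoʳ-≤ (J * q) (m⊓n≤m J r) ⟩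
    J * q + J                             ≡⟨ trans (+-comm (J * q) J) (sym (*-suc J q)) ⟩
    J * suc q                             ≤⟨ *-monoʳ-≤ J (≰⇒> fj≰q) ⟩
    J * f j                               ≤⟨ prefixSum-lower f J J≤n (λ k k<J → antitone (≤-pred k<J)) ⟩
    prefixSum f J                         ∎

ceilDiv-suc : ∀ x d → 0 < x % suc d → ceilDiv x (suc d) ≡ suc (x / suc d)
ceilDiv-suc x d 0<r = begin
  (x + d) / suc d                              ≡⟨ /-congˡ x+d≡ ⟩
  (r ∸ 1 + suc q * suc d) / suc d              ≡⟨ +-distrib-/-∣ʳ (r ∸ 1) (n∣m*n (suc q)) ⟩
  (r ∸ 1) / suc d + suc q * suc d / suc d      ≡⟨ cong₂ _+_ (m<n⇒m/n≡0 r∸1<Δ) (m*n/n≡m (suc q) (suc d)) ⟩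
  suc q                                        ∎
  where
  open ≡-Reasoning
  r = x % suc d
  q = x / suc d
  r∸1<Δ : r ∸ 1 < suc d
  r∸1<Δ = ≤-<-trans (m∸n≤m r 1) (m%n<n x (suc d))
  regroup : ∀ a b c → a + 1 + b * suc c + c ≡ a + suc b * suc c
  regroup = solve-∀
  x+d≡ : x + d ≡ r ∸ 1 + suc q * suc d
  x+d≡ = begin
    x + d                        ≡⟨ cong (_+ d) (m≡m%n+[m/n]*n x (suc d)) ⟩
    r + q * suc d + d            ≡⟨ cong (λ t → t + q * suc d + d) (sym (m∸n+n≡m 0<r)) ⟩
    r ∸ 1 + 1 + q * suc d + d    ≡⟨ regroup (r ∸ 1) q d ⟩
    r ∸ 1 + suc q * suc d        ∎

balanced≗staircase : ∀ d x → balanced (suc d) x ≗ staircase (suc d) (x / suc d) (x % suc d)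
balanced≗staircase d x k with toℕ k <? x % suc d
... | yes k<r = ceilDiv-suc x d (≤-<-trans z≤n k<r)
... | no  _   = refl

mainTheorem8 : (Δ x : ℕ) → .{{_ : NonZero Δ}} → 1 ≤ x →
    (p' : Vecℕ Δ) → IsPotential Δ p' → ω p' ≡ ω (balanced Δ x) → p' ≽ balanced Δ x
mainTheorem8 (suc d) x _ p' potential same-value =
  ≽-respʳ {f = p'} (sym ∘ balanced≗staircase d x)
    (antitone⇒≽staircase p' q r (IsPotential⇒antitone potential) same-total)
  where
  q = x / suc d
  r = x % suc d
  same-total : sumFin (staircase (suc d) q r) ≤ sumFin p'
  same-total = ≤-reflexive (trans (sym (sumFin-cong (balanced≗staircase d x))) (sym same-value))
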